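{- Let $n,k$ be nonnegative integers and let $\mathcal{I}$ be a nonempty family of subsets of $[n]=\{1,\dots,n\}$ such that $|A|=k$ for all $A\in\mathcal{I}$. Then for every $A,B\in\mathcal{I}$ and every $i\in A\setminus B$, there exist $E\subseteq A\setminus B$ and $F\subseteq B\setminus A$ such that: (1) $|E|=|F|$; (2) $i\in E$; (3) $(A\setminus E)\cup F\in\mathcal{I}$; (4) for all $M,N\in\mathcal{I}$, if $e_A+e_{(A\setminus E)\cup F}=e_M+e_N$, then $\{A,(A\setminus E)\cup F\}=\{M,N\}$.
   Context: $\mathbb{R}^{[n]}$ denotes the real vector space with standard basis $e_1,\dots,e_n$, and for $A\subseteq[n]$ the indicator vector is $e_A=\sum_{a\in A}e_a$. -}

module Defs where

open import Data.Nat using (ℕ; _+_)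
open import Data.Bool using (Bool; true; false)
open import Data.Fin using (Fin)
open import Data.Vec using (lookup)
open import Data.Fin.Subset using (Subset)

-- Indicator vector e_A : Fin n → ℕ, with e_A(i) = 1 if i ∈ A and 0 otherwise.
-- (Entries are 0/1, so equalities of sums of such vectors in ℝ^[n] are
-- exactly the coordinatewise equalities of these ℕ-valued sums.)
indicator : ∀ {n} → Subset n → Fin n → ℕ
indicator A i with lookup A i
... | true  = 1
... | false = 0

_⊕_ : ∀ {n} → Subset n → Subset n → Fin n → ℕ
(A ⊕ B) i = indicator A i + indicator B i

-- Among the members C of 𝓘 that lie between A and B (A ∖ C ⊆ A ∖ B and C ∖ A ⊆ B ∖ A) and
-- avoid i, choose one with |A ∖ C| minimal; B itself is such a member. Take E = A ∖ C and
-- F = C ∖ A, so that (A ∖ E) ∪ F = C. If e_A + e_C = e_M + e_N, then coordinatewise (M, N) is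
-- (A, C) with some entries swapped; as i ∈ A ∖ C, one of M, N, say M, avoids i, and M lies
-- between A and C, hence between A and B. Minimality forces A ∖ M = A ∖ C, and since all
-- members of 𝓘 have size k also M ∖ A = C ∖ A; so M = C, and then N = A.
module Submission where

open import Defs
open import Data.Nat using (ℕ)
open import Data.Fin using (Fin)
open import Data.Fin.Subset using (Subset; _∈_; _∉_; _⊆_; _─_; _∪_; ∣_∣)
open import Data.List using (List; _∷_)
open import Data.List.Membership.Propositional using () renaming (_∈_ to _∈ₗ_)
open import Data.Product using (Σ; ∃; _×_; _,_)
open import Data.Sum using (_⊎_)
open import Relation.Binary.PropositionalEquality using (_≡_)

open import Data.Bool using (Bool; true; false)
open import Data.Empty using (⊥-elim)
open import Data.Fin.Subset using (inside; outside)
open import Data.Fin.Subset.Properties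
  using (_⊆?_; _∈?_; ⊆-refl; ⊆-trans; drop-∷-⊆; p─q⊆p; x∈p∧x∉q⇒x∈p─q; p⊆q⇒∣p∣≤∣q∣)
open import Data.List using (filter)
open import Data.List.Membership.Propositional.Properties using (∈-filter⁺; ∈-filter⁻)
import Data.List.Relation.Unary.All as All
open import Data.Nat using (suc; _+_; _≤_; pred)
open import Data.Nat.Properties using (+-suc; +-cancelˡ-≡; ≤-antisym; <-irrefl; ≤-totalOrder)
open import Data.List.Extrema ≤-totalOrder using (argmin; argmin-all; f[argmin]≤f[xs])
open import Data.Product using (proj₁; proj₂)
import Data.Product as Product
open import Data.Sum using (inj₁; inj₂)
import Data.Sum as Sum
open import Data.Vec using (_∷_; []; here; there; lookup; tabulate)
open import Data.Vec.Properties using ([]=⇒lookup; lookup⇒[]=; tabulate∘lookup; tabulate-cong)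
open import Relation.Nullary using (¬?)
open import Relation.Nullary.Decidable using (_×-dec_)
open import Relation.Unary using (Pred; Decidable)
open import Relation.Binary.PropositionalEquality using (refl; sym; trans; cong; cong₂; subst; module ≡-Reasoning)

∃-argmin : ∀ {a p} {X : Set a} {P : Pred X p} → Decidable P → (f : X → ℕ)
         → ∀ {x xs} → x ∈ₗ xs → P x
         → ∃ λ y → y ∈ₗ xs × P y × (∀ {z} → z ∈ₗ xs → P z → f y ≤ f z)
∃-argmin {P = P} P? f {x} {xs} x∈xs px =
  argmin f x candidates , proj₁ y-ok , proj₂ y-ok , minimal
  where
  candidates = filter P? xs
  y-ok = argmin-all f (x∈xs , px) (All.tabulate (∈-filter⁻ P?))
  minimal : ∀ {z} → z ∈ₗ xs → P z → f (argmin f x candidates) ≤ f z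
  minimal z∈xs pz = All.lookup (f[argmin]≤f[xs] x candidates) (∈-filter⁺ P? z∈xs pz)

lookup-ext : ∀ {n} {p q : Subset n} → (∀ j → lookup p j ≡ lookup q j) → p ≡ q
lookup-ext {p = p} {q} p≗q = begin
  p                   ≡⟨ sym (tabulate∘lookup p) ⟩
  tabulate (lookup p) ≡⟨ tabulate-cong p≗q ⟩
  tabulate (lookup q) ≡⟨ tabulate∘lookup q ⟩
  q                   ∎
  where open ≡-Reasoning

∈-resp-lookup : ∀ {n} {p q : Subset n} {x} → lookup p x ≡ lookup q x → x ∈ p → x ∈ q
∈-resp-lookup {p = p} {q} {x} eq x∈p = lookup⇒[]= x q (trans (sym eq) ([]=⇒lookup x∈p))

x∈p─q⇒x∉q : ∀ {n} (p q : Subset n) {x} → x ∈ p ─ q → x ∉ q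
x∈p─q⇒x∉q (inside ∷ p) (outside ∷ q) here        ()
x∈p─q⇒x∉q (_ ∷ p)      (_ ∷ q)       (there x∈) (there x∈q) = x∈p─q⇒x∉q p q x∈ x∈q

p─[p─q]∪q─p≡q : ∀ {n} (p q : Subset n) → (p ─ (p ─ q)) ∪ (q ─ p) ≡ q
p─[p─q]∪q─p≡q []            []            = refl
p─[p─q]∪q─p≡q (inside  ∷ p) (inside  ∷ q) = cong (inside ∷_)  (p─[p─q]∪q─p≡q p q)
p─[p─q]∪q─p≡q (inside  ∷ p) (outside ∷ q) = cong (outside ∷_) (p─[p─q]∪q─p≡q p q)
p─[p─q]∪q─p≡q (outside ∷ p) (inside  ∷ q) = cong (inside ∷_)  (p─[p─q]∪q─p≡q p q)
p─[p─q]∪q─p≡q (outside ∷ p) (outside ∷ q) = cong (outside ∷_) (p─[p─q]∪q─p≡q p q)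

∣p∣+∣q─p∣≡∣q∣+∣p─q∣ : ∀ {n} (p q : Subset n) → ∣ p ∣ + ∣ q ─ p ∣ ≡ ∣ q ∣ + ∣ p ─ q ∣
∣p∣+∣q─p∣≡∣q∣+∣p─q∣ []            []            = refl
∣p∣+∣q─p∣≡∣q∣+∣p─q∣ (inside  ∷ p) (inside  ∷ q) = cong suc (∣p∣+∣q─p∣≡∣q∣+∣p─q∣ p q)
∣p∣+∣q─p∣≡∣q∣+∣p─q∣ (outside ∷ p) (outside ∷ q) = ∣p∣+∣q─p∣≡∣q∣+∣p─q∣ p q
∣p∣+∣q─p∣≡∣q∣+∣p─q∣ (inside  ∷ p) (outside ∷ q) =
  trans (cong suc (∣p∣+∣q─p∣≡∣q∣+∣p─q∣ p q)) (sym (+-suc ∣ q ∣ ∣ p ─ q ∣))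
∣p∣+∣q─p∣≡∣q∣+∣p─q∣ (outside ∷ p) (inside  ∷ q) =
  trans (+-suc ∣ p ∣ ∣ q ─ p ∣) (cong suc (∣p∣+∣q─p∣≡∣q∣+∣p─q∣ p q))

∣p∣≡∣q∣⇒∣p─q∣≡∣q─p∣ : ∀ {n} (p q : Subset n) → ∣ p ∣ ≡ ∣ q ∣ → ∣ p ─ q ∣ ≡ ∣ q ─ p ∣
∣p∣≡∣q∣⇒∣p─q∣≡∣q─p∣ p q ∣p∣≡∣q∣ = sym (+-cancelˡ-≡ ∣ q ∣ _ _ (begin
  ∣ q ∣ + ∣ q ─ p ∣ ≡⟨ cong (_+ ∣ q ─ p ∣) (sym ∣p∣≡∣q∣) ⟩
  ∣ p ∣ + ∣ q ─ p ∣ ≡⟨ ∣p∣+∣q─p∣≡∣q∣+∣p─q∣ p q ⟩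
  ∣ q ∣ + ∣ p ─ q ∣ ∎))
  where open ≡-Reasoning

p⊆q∧∣p∣≡∣q∣⇒p≡q : ∀ {n} {p q : Subset n} → p ⊆ q → ∣ p ∣ ≡ ∣ q ∣ → p ≡ q
p⊆q∧∣p∣≡∣q∣⇒p≡q {p = []}          {[]}          _   _     = refl
p⊆q∧∣p∣≡∣q∣⇒p≡q {p = inside  ∷ p} {inside  ∷ q} p⊆q ∣p∣≡∣q∣ =
  cong (inside ∷_) (p⊆q∧∣p∣≡∣q∣⇒p≡q (drop-∷-⊆ p⊆q) (cong pred ∣p∣≡∣q∣))
p⊆q∧∣p∣≡∣q∣⇒p≡q {p = outside ∷ p} {outside ∷ q} p⊆q ∣p∣≡∣q∣ =
  cong (outside ∷_) (p⊆q∧∣p∣≡∣q∣⇒p≡q (drop-∷-⊆ p⊆q) ∣p∣≡∣q∣)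
p⊆q∧∣p∣≡∣q∣⇒p≡q {p = inside  ∷ p} {outside ∷ q} p⊆q _ with p⊆q here
... | ()
p⊆q∧∣p∣≡∣q∣⇒p≡q {p = outside ∷ p} {inside  ∷ q} p⊆q ∣p∣≡∣q∣ =
  ⊥-elim (<-irrefl refl (subst (_≤ ∣ q ∣) ∣p∣≡∣q∣ (p⊆q⇒∣p∣≤∣q∣ (drop-∷-⊆ p⊆q))))

bit : Bool → ℕ
bit true  = 1
bit false = 0

indicator≡bit∘lookup : ∀ {n} (p : Subset n) j → indicator p j ≡ bit (lookup p j)
indicator≡bit∘lookup p j with lookup p j
... | true  = refl
... | false = refl

bit-+-exchange : ∀ a c m n → bit a + bit c ≡ bit m + bit n
               → (m ≡ a × n ≡ c) ⊎ (m ≡ c × n ≡ a)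
bit-+-exchange false false false false _  = inj₁ (refl , refl)
bit-+-exchange true  true  true  true  _  = inj₁ (refl , refl)
bit-+-exchange true  false true  false _  = inj₁ (refl , refl)
bit-+-exchange false true  false true  _  = inj₁ (refl , refl)
bit-+-exchange true  false false true  _  = inj₂ (refl , refl)
bit-+-exchange false true  true  false _  = inj₂ (refl , refl)
bit-+-exchange false false false true  ()
bit-+-exchange false false true  _     ()
bit-+-exchange false true  false false ()
bit-+-exchange false true  true  true  ()
bit-+-exchange true  false false false ()
bit-+-exchange true  false true  true  ()
bit-+-exchange true  true  false false ()
bit-+-exchange true  true  false true  ()
bit-+-exchange true  true  true  false ()

record Exchange {n} (A C M N : Subset n) : Set where
  constructor exchange
  field
    at : ∀ j → (lookup M j ≡ lookup A j × lookup N j ≡ lookup C j)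
             ⊎ (lookup M j ≡ lookup C j × lookup N j ≡ lookup A j)

⊕-≗⇒Exchange : ∀ {n} {A C M N : Subset n} → (∀ j → (A ⊕ C) j ≡ (M ⊕ N) j) → Exchange A C M N
⊕-≗⇒Exchange {A = A} {C} {M} {N} eq = exchange λ j →
  bit-+-exchange (lookup A j) (lookup C j) (lookup M j) (lookup N j) (begin
    bit (lookup A j) + bit (lookup C j) ≡⟨ sym (cong₂ _+_ (indicator≡bit∘lookup A j) (indicator≡bit∘lookup C j)) ⟩
    (A ⊕ C) j                           ≡⟨ eq j ⟩
    (M ⊕ N) j                           ≡⟨ cong₂ _+_ (indicator≡bit∘lookup M j) (indicator≡bit∘lookup N j) ⟩
    bit (lookup M j) + bit (lookup N j) ∎)
  where open ≡-Reasoning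

module _ {n} {A C M N : Subset n} (ex : Exchange A C M N) where

  open Exchange ex

  Exchange-swap : Exchange A C N M
  Exchange-swap = exchange λ j → Sum.map Product.swap Product.swap (Sum.swap (at j))

  ∈A∩C⇒∈M : ∀ {x} → x ∈ A → x ∈ C → x ∈ M
  ∈A∩C⇒∈M {x} x∈A x∈C with at x
  ... | inj₁ (Mx≡Ax , _) = ∈-resp-lookup (sym Mx≡Ax) x∈A
  ... | inj₂ (Mx≡Cx , _) = ∈-resp-lookup (sym Mx≡Cx) x∈C

  ∈M─A⇒∈C : ∀ {x} → x ∈ M → x ∉ A → x ∈ C
  ∈M─A⇒∈C {x} x∈M x∉A with at x
  ... | inj₁ (Mx≡Ax , _) = ⊥-elim (x∉A (∈-resp-lookup Mx≡Ax x∈M))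
  ... | inj₂ (Mx≡Cx , _) = ∈-resp-lookup Mx≡Cx x∈M

  Exchange⇒A─M⊆A─C : A ─ M ⊆ A ─ C
  Exchange⇒A─M⊆A─C x∈A─M = x∈p∧x∉q⇒x∈p─q x∈A (λ x∈C → x∈p─q⇒x∉q A M x∈A─M (∈A∩C⇒∈M x∈A x∈C))
    where x∈A = p─q⊆p A M x∈A─M

  Exchange⇒M─A⊆C─A : M ─ A ⊆ C ─ A
  Exchange⇒M─A⊆C─A x∈M─A = x∈p∧x∉q⇒x∈p─q (∈M─A⇒∈C (p─q⊆p M A x∈M─A) x∉A) x∉A
    where x∉A = x∈p─q⇒x∉q M A x∈M─A

  Exchange⇒∉⊎∉ : ∀ {x} → x ∈ A → x ∉ C → x ∉ M ⊎ x ∉ N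
  Exchange⇒∉⊎∉ {x} x∈A x∉C with at x
  ... | inj₁ (_ , Nx≡Cx) = inj₂ (λ x∈N → x∉C (∈-resp-lookup Nx≡Cx x∈N))
  ... | inj₂ (Mx≡Cx , _) = inj₁ (λ x∈M → x∉C (∈-resp-lookup Mx≡Cx x∈M))

  Exchange⇒M≡C⇒N≡A : M ≡ C → N ≡ A
  Exchange⇒M≡C⇒N≡A refl = lookup-ext N≗A
    where
    N≗A : ∀ j → lookup N j ≡ lookup A j
    N≗A j with at j
    ... | inj₁ (Mj≡Aj , Nj≡Cj) = trans Nj≡Cj Mj≡Aj
    ... | inj₂ (_ , Nj≡Aj)     = Nj≡Aj

Admissible : ∀ {n} → Subset n → Subset n → Fin n → Subset n → Set
Admissible A B i C = A ─ C ⊆ A ─ B × C ─ A ⊆ B ─ A × i ∉ C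

admissible? : ∀ {n} (A B : Subset n) i → Decidable (Admissible A B i)
admissible? A B i C = (A ─ C ⊆? A ─ B) ×-dec ((C ─ A ⊆? B ─ A) ×-dec ¬? (i ∈? C))

UniqueDecomposition : ∀ {n} → List (Subset n) → Subset n → Subset n → Set
UniqueDecomposition 𝓘 A C = ∀ M N → M ∈ₗ 𝓘 → N ∈ₗ 𝓘
  → (∀ j → (A ⊕ C) j ≡ (M ⊕ N) j)
  → (A ≡ M × C ≡ N) ⊎ (A ≡ N × C ≡ M)

module _ {n k} {𝓘 : List (Subset n)} (uniform : ∀ A → A ∈ₗ 𝓘 → ∣ A ∣ ≡ k) {A} (A∈𝓘 : A ∈ₗ 𝓘) where

  ∣A─M∣≡∣M─A∣ : ∀ {M} → M ∈ₗ 𝓘 → ∣ A ─ M ∣ ≡ ∣ M ─ A ∣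
  ∣A─M∣≡∣M─A∣ {M} M∈𝓘 = ∣p∣≡∣q∣⇒∣p─q∣≡∣q─p∣ A M (trans (uniform A A∈𝓘) (sym (uniform M M∈𝓘)))

  module _ {B i C} (C∈𝓘 : C ∈ₗ 𝓘) (adm : Admissible A B i C)
           (minimal : ∀ {M} → M ∈ₗ 𝓘 → Admissible A B i M → ∣ A ─ C ∣ ≤ ∣ A ─ M ∣) where

    minimal-admissible-unique : ∀ {M N} → M ∈ₗ 𝓘 → Exchange A C M N → i ∉ M → M ≡ C
    minimal-admissible-unique {M} M∈𝓘 ex i∉M = begin
      M                       ≡⟨ sym (p─[p─q]∪q─p≡q A M) ⟩
      (A ─ (A ─ M)) ∪ (M ─ A) ≡⟨ cong₂ (λ E F → (A ─ E) ∪ F) A─M≡A─C M─A≡C─A ⟩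
      (A ─ (A ─ C)) ∪ (C ─ A) ≡⟨ p─[p─q]∪q─p≡q A C ⟩
      C                       ∎
      where
      open ≡-Reasoning
      A─M⊆A─C = Exchange⇒A─M⊆A─C ex
      M─A⊆C─A = Exchange⇒M─A⊆C─A ex
      M-admissible : Admissible A B i M
      M-admissible = ⊆-trans A─M⊆A─C (proj₁ adm) , ⊆-trans M─A⊆C─A (proj₁ (proj₂ adm)) , i∉M
      ∣A─M∣≡∣A─C∣ : ∣ A ─ M ∣ ≡ ∣ A ─ C ∣
      ∣A─M∣≡∣A─C∣ = ≤-antisym (p⊆q⇒∣p∣≤∣q∣ A─M⊆A─C) (minimal M∈𝓘 M-admissible)
      A─M≡A─C = p⊆q∧∣p∣≡∣q∣⇒p≡q A─M⊆A─C ∣A─M∣≡∣A─C∣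
      M─A≡C─A = p⊆q∧∣p∣≡∣q∣⇒p≡q M─A⊆C─A
        (trans (sym (∣A─M∣≡∣M─A∣ M∈𝓘)) (trans ∣A─M∣≡∣A─C∣ (∣A─M∣≡∣M─A∣ C∈𝓘)))

    Exchange⇒same-pair : i ∈ A → ∀ {M N} → M ∈ₗ 𝓘 → N ∈ₗ 𝓘 → Exchange A C M N
                       → (A ≡ M × C ≡ N) ⊎ (A ≡ N × C ≡ M)
    Exchange⇒same-pair i∈A M∈𝓘 N∈𝓘 ex with Exchange⇒∉⊎∉ ex i∈A (proj₂ (proj₂ adm))
    ... | inj₁ i∉M = inj₂ (sym (Exchange⇒M≡C⇒N≡A ex M≡C) , sym M≡C)
      where M≡C = minimal-admissible-unique M∈𝓘 ex i∉M
    ... | inj₂ i∉N = inj₁ (sym (Exchange⇒M≡C⇒N≡A (Exchange-swap ex) N≡C) , sym N≡C)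
      where N≡C = minimal-admissible-unique N∈𝓘 (Exchange-swap ex) i∉N

    minimal-admissible-uniqueDecomposition : i ∈ A → UniqueDecomposition 𝓘 A C
    minimal-admissible-uniqueDecomposition i∈A M N M∈𝓘 N∈𝓘 sum =
      Exchange⇒same-pair i∈A M∈𝓘 N∈𝓘 (⊕-≗⇒Exchange sum)

lemma7p1 : (n k : ℕ) (𝓘 : List (Subset n))
    → (∃ λ A → A ∈ₗ 𝓘)
    → (∀ A → A ∈ₗ 𝓘 → ∣ A ∣ ≡ k)
    → ∀ A B → A ∈ₗ 𝓘 → B ∈ₗ 𝓘 → (i : Fin n) → i ∈ A → i ∉ B
    → Σ (Subset n) λ E → Σ (Subset n) λ F →
        E ⊆ (A ─ B) × F ⊆ (B ─ A)
        × ∣ E ∣ ≡ ∣ F ∣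
        × i ∈ E
        × ((A ─ E) ∪ F) ∈ₗ 𝓘
        × (∀ M N → M ∈ₗ 𝓘 → N ∈ₗ 𝓘
             → (∀ j → (A ⊕ ((A ─ E) ∪ F)) j ≡ (M ⊕ N) j)
             → ((A ≡ M × ((A ─ E) ∪ F) ≡ N) ⊎ (A ≡ N × ((A ─ E) ∪ F) ≡ M)))
lemma7p1 n k 𝓘 _ uniform A B A∈𝓘 B∈𝓘 i i∈A i∉B
  with C , C∈𝓘 , adm@(A─C⊆A─B , C─A⊆B─A , i∉C) , minimal
         ← ∃-argmin (admissible? A B i) (λ C → ∣ A ─ C ∣) B∈𝓘 (⊆-refl , ⊆-refl , i∉B)
  = A ─ C , C ─ A , A─C⊆A─B , C─A⊆B─A
  , ∣A─M∣≡∣M─A∣ uniform A∈𝓘 C∈𝓘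
  , x∈p∧x∉q⇒x∈p─q i∈A i∉C
  , subst (_∈ₗ 𝓘) (sym (p─[p─q]∪q─p≡q A C)) C∈𝓘
  , subst (UniqueDecomposition 𝓘 A) (sym (p─[p─q]∪q─p≡q A C))
      (minimal-admissible-uniqueDecomposition uniform A∈𝓘 C∈𝓘 adm minimal i∈A)
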